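{- Let $\mathcal{H}$ be a $k$-conformal hypergraph on vertex set $V$ with $k\le|V|$. If $E\in\mathrm{ext}_k(\mathcal{H})$, then there exists $F\in\mathcal{H}$ such that $E\subseteq F$.
   Context: A hypergraph $\mathcal{H}$ on a finite set $V$ is $k$-conformal if every inclusion-minimal subset of $V$ that is not contained in any hyperedge of $\mathcal{H}$ has size at most $k$. A $k$-trace on $V$ is a pair $(T,S)$ with $T\subseteq S\subseteq V$, $|S|=k$; a set $F\subseteq V$ realizes $(T,S)$ if $F\cap S=T$; $\mathrm{traces}_k(F)$ is the set of $k$-traces on $V$ realized by $F$ and $\mathrm{traces}_k(\mathcal{H})=\bigcup_{F\in\mathcal{H}}\mathrm{traces}_k(F)$. The $k$-extension $\mathrm{ext}_k(\mathcal{H})$ is the hypergraph on $V$ whose hyperedges are all $E\subseteq V$ with $\mathrm{traces}_k(E)\subseteq\mathrm{traces}_k(\mathcal{H})$. -}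

module Defs where

open import Data.Nat using (ℕ; _≤_)
open import Data.Fin.Subset using (Subset; _⊆_; _⊂_; _∩_; ∣_∣)
open import Data.List using (List)
open import Data.List.Membership.Propositional using (_∈_)
open import Data.Product using (Σ; ∃; _×_)
open import Relation.Binary.PropositionalEquality using (_≡_)
open import Relation.Nullary using (¬_)

-- A hypergraph on the vertex set V = Fin n: a finite list of hyperedges.
Hypergraph : ℕ → Set
Hypergraph n = List (Subset n)

Covered : ∀ {n} → Hypergraph n → Subset n → Set
Covered H X = ∃ λ F → F ∈ H × X ⊆ F

MinimalNonCovered : ∀ {n} → Hypergraph n → Subset n → Set
MinimalNonCovered H X = ¬ Covered H X × (∀ Y → Y ⊂ X → Covered H Y)

Conformal : ∀ {n} → ℕ → Hypergraph n → Set
Conformal k H = ∀ X → MinimalNonCovered H X → ∣ X ∣ ≤ k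

IsTrace : ∀ {n} → ℕ → Subset n → Subset n → Set
IsTrace k T S = T ⊆ S × ∣ S ∣ ≡ k

Realizes : ∀ {n} → Subset n → Subset n → Subset n → Set
Realizes F T S = F ∩ S ≡ T

InTraces : ∀ {n} → ℕ → Subset n → Subset n → Subset n → Set
InTraces k F T S = IsTrace k T S × Realizes F T S

InTracesH : ∀ {n} → ℕ → Hypergraph n → Subset n → Subset n → Set
InTracesH k H T S = ∃ λ F → F ∈ H × InTraces k F T S

InExt : ∀ {n} → ℕ → Hypergraph n → Subset n → Set
InExt k H E = ∀ T S → InTraces k E T S → InTracesH k H T S

{-# OPTIONS --safe #-}
-- If E is not covered, it contains an inclusion-minimal non-covered set X, which has at most
-- k elements by conformality. Pad X to a k-set S. The trace (E ∩ S, S) of E is realized by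
-- some hyperedge F, and then X ⊆ E ∩ S = F ∩ S ⊆ F, contradicting the choice of X.
module Submission where

open import Defs
open import Data.Nat using (ℕ; suc; _≤_; s≤s; z≤n)
open import Data.Nat.Properties using (m≤n⇒m<n∨m≡n)
open import Data.Fin.Subset using (Subset; _⊆_; _⊂_; _∩_; ∣_∣; ⊤; inside; outside)
open import Data.Fin.Subset.Properties
  using (⊆-preorder; ⊆-refl; ⊆-trans; ⊆⊤; ∣⊤∣≡n; in⊆in; out⊆; _⊆?_; _⊂?_; anySubset?; p∩q⊆p; p∩q⊆q; x∈p∩q⁺)
open import Data.Fin.Subset.Induction using (⊂-wellFounded)
open import Data.List.Membership.Propositional using (_∈_; find; lose)
open import Data.List.Relation.Unary.Any using (any?)
open import Data.Product using (∃; _×_; _,_)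
open import Data.Empty using (⊥-elim)
open import Data.Sum using (inj₁; inj₂)
open import Data.Vec using ([]; _∷_)
open import Function using (_∘_)
open import Induction.WellFounded using (Acc; acc)
open import Relation.Nullary using (¬_; Dec; yes; no)
open import Relation.Nullary.Decidable using (_×-dec_; ¬?; decidable-stable)
open import Relation.Unary using (Pred; Decidable)
open import Relation.Binary.PropositionalEquality using (_≡_; refl; sym; cong)
import Relation.Binary.Reasoning.Preorder as PreorderReasoning

private
  variable
    n : ℕ

  module ⊆-Reasoning {n} = PreorderReasoning (⊆-preorder n)

covered? : (H : Hypergraph n) (X : Subset n) → Dec (Covered H X)
covered? H X with any? (X ⊆?_) H
... | yes X⊆some = yes (find X⊆some)
... | no ¬X⊆any  = no λ (F , F∈H , X⊆F) → ¬X⊆any (lose F∈H X⊆F)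

⊂-minimal-⊆ : ∀ {ℓ} {P : Pred (Subset n) ℓ} → Decidable P → ∀ {X} → P X →
              ∃ λ Y → Y ⊆ X × P Y × (∀ Z → Z ⊂ Y → ¬ P Z)
⊂-minimal-⊆ {P = P} P? {X} PX = go X (⊂-wellFounded X) PX
  where
  go : ∀ X → Acc _⊂_ X → P X → ∃ λ Y → Y ⊆ X × P Y × (∀ Z → Z ⊂ Y → ¬ P Z)
  go X (acc rec) PX with anySubset? (λ Z → (Z ⊂? X) ×-dec P? Z)
  ... | no ¬smaller = X , ⊆-refl , PX , λ Z Z⊂X PZ → ¬smaller (Z , Z⊂X , PZ)
  ... | yes (Z , Z⊂X@(Z⊆X , _) , PZ) with go Z (rec Z⊂X) PZ
  ...   | Y , Y⊆Z , PY , minimal = Y , ⊆-trans Y⊆Z Z⊆X , PY , minimal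

minimalNonCovered-⊆ : (H : Hypergraph n) {E : Subset n} → ¬ Covered H E →
                      ∃ λ X → X ⊆ E × MinimalNonCovered H X
minimalNonCovered-⊆ H ¬covered with ⊂-minimal-⊆ (¬? ∘ covered? H) ¬covered
... | X , X⊆E , ¬coveredX , minimal =
  X , X⊆E , ¬coveredX , λ Y Y⊂X → decidable-stable (covered? H Y) (minimal Y Y⊂X)

superset-ofSize : ∀ {k} (X : Subset n) → ∣ X ∣ ≤ k → k ≤ n → ∃ λ S → X ⊆ S × ∣ S ∣ ≡ k
superset-ofSize []            z≤n       z≤n       = [] , ⊆-refl , refl
superset-ofSize (inside ∷ X)  (s≤s X≤k) (s≤s k≤n) with superset-ofSize X X≤k k≤n
... | S , X⊆S , ∣S∣≡k = inside ∷ S , in⊆in X⊆S , cong suc ∣S∣≡k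
superset-ofSize (outside ∷ X) X≤k       k≤1+n     with m≤n⇒m<n∨m≡n k≤1+n
... | inj₂ refl       = ⊤ , ⊆⊤ , ∣⊤∣≡n _
... | inj₁ (s≤s k≤n) with superset-ofSize X X≤k k≤n
...   | S , X⊆S , ∣S∣≡k = outside ∷ S , out⊆ X⊆S , ∣S∣≡k

InExt⇒small⇒Covered : ∀ {k} {H : Hypergraph n} {E X : Subset n} → InExt k H E → k ≤ n →
                      X ⊆ E → ∣ X ∣ ≤ k → Covered H X
InExt⇒small⇒Covered {E = E} {X} ext k≤n X⊆E ∣X∣≤k
  with superset-ofSize X ∣X∣≤k k≤n
... | S , X⊆S , ∣S∣≡k with ext (E ∩ S) S ((p∩q⊆q E S , ∣S∣≡k) , refl)
...   | F , F∈H , _ , F∩S≡E∩S = F , F∈H , X⊆F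
  where
  X⊆F : X ⊆ F
  X⊆F = begin
    X      ∼⟨ (λ x∈X → x∈p∩q⁺ (X⊆E x∈X , X⊆S x∈X)) ⟩
    E ∩ S  ≡⟨ sym F∩S≡E∩S ⟩
    F ∩ S  ∼⟨ p∩q⊆p F S ⟩
    F      ∎
    where open ⊆-Reasoning

proposition2 : (n k : ℕ) (H : Hypergraph n) → Conformal k H → k ≤ n →
               (E : Subset n) → InExt k H E →
               ∃ λ F → F ∈ H × E ⊆ F
proposition2 n k H conformal k≤n E ext with covered? H E
... | yes covered = covered
... | no ¬covered with minimalNonCovered-⊆ H ¬covered
...   | X , X⊆E , ¬coveredX , minimal =
  ⊥-elim (¬coveredX (InExt⇒small⇒Covered ext k≤n X⊆E (conformal X (¬coveredX , minimal))))
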